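{- Let $G$ be a graph, $x^0$ an optimal basic feasible solution of $\mathrm{ELP}(G)$ with objective value $z(x^0)$, and $(i,j)$ an edge of $G$ with $x^0_i+x^0_j\ge \frac43$. Let $\bar G^{\{i,j\}}=G\setminus\{i,j\}$ (delete vertices $i,j$ and incident edges) and let $\bar x$ be an optimal basic feasible solution of $\mathrm{ELP}(\bar G^{\{i,j\}})$ with objective value $\bar z(\bar x)$. Then $\bar z(\bar x)\le z(x^0)-\frac43$.
   Context: For a graph $H$, $\mathrm{ELP}(H)$ is the linear program: minimize $\sum_{v\in V(H)} x_v$ subject to $x_u+x_v\ge 1$ for every edge $(u,v)$ of $H$, $\sum_{v\in V(C)} x_v\ge s+1$ for every odd cycle $C$ of $H$ with $2s+1$ vertices, and $x\ge 0$. A basic feasible solution is a vertex of its feasible polyhedron.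
   Formalization: The solutions $x^0$ and $\bar x$, and all feasible points against which their extremality and optimality are tested, have rational coordinates. -}

module Defs where

open import Data.Bool using (Bool; true; false)
open import Data.Nat as ℕ using (ℕ; zero; suc)
open import Data.Nat.DivMod using (_mod_)
open import Data.Fin using (Fin; zero; suc; toℕ; punchIn; punchOut)
open import Data.Integer using (+_)
open import Data.Rational using (ℚ; 0ℚ; _+_; _-_; _≤_; _/_)
open import Data.Product using (Σ; _×_)
open import Function.Definitions using (Injective)
open import Relation.Binary.PropositionalEquality using (_≡_; _≢_; refl; cong; trans) renaming (sym to sym≡)
open import Relation.Nullary using (¬_)

record Graph (n : ℕ) : Set where
  field
    adj    : Fin n → Fin n → Bool
    sym    : ∀ u v → adj u v ≡ adj v u
    irrefl : ∀ v → adj v v ≡ false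
open Graph public

Adj : ∀ {n} → Graph n → Fin n → Fin n → Set
Adj G u v = adj G u v ≡ true

Adj⇒≢ : ∀ {n} (G : Graph n) {u v : Fin n} → Adj G u v → u ≢ v
Adj⇒≢ G {u} e refl with trans (sym≡ e) (irrefl G u)
... | ()

csucc : ∀ {m} → Fin (suc m) → Fin (suc m)
csucc {m} k = suc (toℕ k) mod (suc m)

OddCycle : ∀ {n} → Graph n → ℕ → Set
OddCycle {n} G s =
  Σ (Fin (suc (2 ℕ.* s)) → Fin n) λ c →
    Injective _≡_ _≡_ c × (∀ k → Adj G (c k) (c (csucc k)))

sumᶠ : ∀ {n} → (Fin n → ℚ) → ℚ
sumᶠ {zero}  f = 0ℚ
sumᶠ {suc n} f = f zero + sumᶠ (λ k → f (suc k))

obj : ∀ {n} → (Fin n → ℚ) → ℚ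
obj = sumᶠ

Feasible : ∀ {n} → Graph n → (Fin n → ℚ) → Set
Feasible {n} G x =
  (∀ u v → Adj G u v → 1ℚ' ≤ x u + x v) ×
  (∀ (s : ℕ) (C : OddCycle G s) →
     (+ suc s) / 1 ≤ sumᶠ (λ k → x (Σ.proj₁ C k))) ×
  (∀ v → 0ℚ ≤ x v)
  where 1ℚ' = (+ 1) / 1

-- Basic feasible solution = vertex (extreme point) of the feasible polyhedron:
-- feasible, and not the midpoint of two distinct feasible points.
BFS : ∀ {n} → Graph n → (Fin n → ℚ) → Set
BFS G x =
  Feasible G x ×
  (∀ (y : Fin _ → ℚ) → Feasible G (λ v → x v + y v) → Feasible G (λ v → x v - y v) →
     ∀ v → y v ≡ 0ℚ)

Optimal : ∀ {n} → Graph n → (Fin n → ℚ) → Set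
Optimal G x = Feasible G x × (∀ y → Feasible G y → obj x ≤ obj y)

OptimalBFS : ∀ {n} → Graph n → (Fin n → ℚ) → Set
OptimalBFS G x = BFS G x × Optimal G x

-- Embedding of Fin m into Fin (2+m) whose image is everything except i and j.
delEmb : ∀ {m} (i j : Fin (suc (suc m))) → i ≢ j → Fin m → Fin (suc (suc m))
delEmb i j i≢j k = punchIn i (punchIn (punchOut i≢j) k)

delete : ∀ {m} (G : Graph (suc (suc m))) (i j : Fin (suc (suc m))) → i ≢ j →
         Graph m
delete G i j i≢j = record
  { adj    = λ u v → adj G (e u) (e v)
  ; sym    = λ u v → sym G (e u) (e v)
  ; irrefl = λ v → irrefl G (e v)
  }
  where e = delEmb i j i≢j

module Submission where

-- Deleting the two endpoints of the edge (i,j) from G leaves an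
-- induced subgraph G∖{i,j}, and the restriction y of x⁰ to it is still
-- feasible for ELP(G∖{i,j}): every edge and every odd cycle of the smaller
-- graph is also one of G.  The objective splits as obj x⁰ = x⁰ᵢ + x⁰ⱼ + obj y,
-- so optimality of x̄ gives
--   obj x̄ ≤ obj y = obj x⁰ − (x⁰ᵢ + x⁰ⱼ) ≤ obj x⁰ − 4/3.

open import Defs
open import Data.Nat using (ℕ; suc)
open import Data.Fin using (Fin; zero; suc; punchIn; punchOut)
open import Data.Fin.Properties using (punchIn-injective; punchIn-punchOut)
open import Data.Integer using (+_)
open import Data.Rational using (ℚ; _+_; _-_; _≤_; _/_; -_)
open import Data.Rational.Properties
  using (+-assoc; +-comm; +-inverseʳ; +-identityʳ; +-monoˡ-≤; ≤-trans; module ≤-Reasoning)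
open import Data.Product using (_,_)
open import Function using (_∘_)
open import Function.Definitions using (Injective)
open import Relation.Binary.PropositionalEquality
  using (_≡_; _≢_; refl; cong; module ≡-Reasoning)

mapOddCycle : ∀ {m n} {H : Graph m} {G : Graph n} (f : Fin m → Fin n) →
  Injective _≡_ _≡_ f → (∀ u v → Adj H u v → Adj G (f u) (f v)) →
  ∀ {s} → OddCycle H s → OddCycle G s
mapOddCycle f f-inj f-adj (c , c-inj , c-adj) =
  f ∘ c , c-inj ∘ f-inj , λ k → f-adj _ _ (c-adj k)

-- Feasibility for ELP pulls back along such maps: every constraint of ELP(H)
-- on x ∘ f is a constraint of ELP(G) on x.
feasiblePullback : ∀ {m n} {H : Graph m} {G : Graph n} (f : Fin m → Fin n) →
  Injective _≡_ _≡_ f → (∀ u v → Adj H u v → Adj G (f u) (f v)) →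
  ∀ {x} → Feasible G x → Feasible H (x ∘ f)
feasiblePullback {H = H} {G = G} f f-inj f-adj (edge , cycle , nonneg) =
    (λ u v uv → edge (f u) (f v) (f-adj u v uv))
  , (λ s C → cycle s (mapOddCycle {H = H} {G = G} f f-inj f-adj {s} C))
  , (λ v → nonneg (f v))

delEmb-injective : ∀ {m} {i j : Fin (suc (suc m))} (i≢j : i ≢ j) →
  Injective _≡_ _≡_ (delEmb i j i≢j)
delEmb-injective {i = i} i≢j =
  punchIn-injective (punchOut i≢j) _ _ ∘ punchIn-injective i _ _

feasibleDelete : ∀ {m} (G : Graph (suc (suc m))) {i j} (i≢j : i ≢ j) {x} →
  Feasible G x → Feasible (delete G i j i≢j) (x ∘ delEmb i j i≢j)
feasibleDelete G {i} {j} i≢j =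
  feasiblePullback {H = delete G i j i≢j} {G = G} (delEmb i j i≢j) (delEmb-injective i≢j) (λ _ _ uv → uv)

sumᶠ-punchIn : ∀ {n} (f : Fin (suc n) → ℚ) (i : Fin (suc n)) →
  sumᶠ f ≡ f i + sumᶠ (f ∘ punchIn i)
sumᶠ-punchIn f zero = refl
sumᶠ-punchIn {suc n} f (suc i) = begin
  f zero + sumᶠ (f ∘ suc)                                ≡⟨ cong (_+_ (f zero)) (sumᶠ-punchIn (f ∘ suc) i) ⟩
  f zero + (f (suc i) + sumᶠ (f ∘ suc ∘ punchIn i))      ≡⟨ +-exchange (f zero) (f (suc i)) _ ⟩
  f (suc i) + (f zero + sumᶠ (f ∘ suc ∘ punchIn i))      ∎
  where
  open ≡-Reasoning
  +-exchange : ∀ a b c → a + (b + c) ≡ b + (a + c)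
  +-exchange a b c = begin
    a + (b + c)  ≡⟨ +-assoc a b c ⟨
    (a + b) + c  ≡⟨ cong (_+ c) (+-comm a b) ⟩
    (b + a) + c  ≡⟨ +-assoc b a c ⟩
    b + (a + c)  ∎

obj-delete : ∀ {m} (x : Fin (suc (suc m)) → ℚ) {i j} (i≢j : i ≢ j) →
  obj x ≡ (x i + x j) + obj (x ∘ delEmb i j i≢j)
obj-delete x {i} {j} i≢j = begin
  obj x                                        ≡⟨ sumᶠ-punchIn x i ⟩
  x i + sumᶠ (x ∘ punchIn i)                   ≡⟨ cong (_+_ (x i)) (sumᶠ-punchIn (x ∘ punchIn i) (punchOut i≢j)) ⟩
  x i + (x (punchIn i (punchOut i≢j)) + rest)  ≡⟨ cong (λ v → x i + (x v + rest)) (punchIn-punchOut i≢j) ⟩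
  x i + (x j + rest)                           ≡⟨ +-assoc (x i) (x j) rest ⟨
  (x i + x j) + rest                           ∎
  where
  open ≡-Reasoning
  rest = obj (x ∘ delEmb i j i≢j)

≤-minus : ∀ {S T p q : ℚ} → T ≡ p + S → q ≤ p → S ≤ T - q
≤-minus {S} {T} {p} {q} T≡p+S q≤p = begin
  S                ≡⟨ cancel ⟨
  (q + S) - q      ≤⟨ +-monoˡ-≤ (- q) (+-monoˡ-≤ S q≤p) ⟩
  (p + S) - q      ≡⟨ cong (_- q) T≡p+S ⟨
  T - q            ∎
  where
  open ≤-Reasoning
  cancel : (q + S) - q ≡ S
  cancel = Eq.begin
    (q + S) - q    Eq.≡⟨ cong (_- q) (+-comm q S) ⟩
    (S + q) - q    Eq.≡⟨ +-assoc S q (- q) ⟩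
    S + (q - q)    Eq.≡⟨ cong (_+_ S) (+-inverseʳ q) ⟩
    S + _          Eq.≡⟨ +-identityʳ S ⟩
    S              Eq.∎
    where module Eq = ≡-Reasoning

lemma5 : ∀ {m : ℕ} (G : Graph (suc (suc m))) (x⁰ : Fin (suc (suc m)) → ℚ) →
    OptimalBFS G x⁰ →
    (i j : Fin (suc (suc m))) (e : Adj G i j) →
    (+ 4) / 3 ≤ x⁰ i + x⁰ j →
    (x̄ : Fin m → ℚ) → OptimalBFS (delete G i j (Adj⇒≢ G e)) x̄ →
    obj x̄ ≤ obj x⁰ - (+ 4) / 3
lemma5 G x⁰ ((x⁰-feasible , _) , _) i j e weight x̄ (_ , (_ , x̄-optimal)) =
  ≤-trans (x̄-optimal y y-feasible) (≤-minus (obj-delete x⁰ i≢j) weight)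
  where
  i≢j = Adj⇒≢ G e
  y = x⁰ ∘ delEmb i j i≢j
  y-feasible = feasibleDelete G i≢j x⁰-feasible
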